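{- Every decomposition rule and every equality rule of $\mathsf{TC}_{\mathsf{SCI}}$ is sound: for each such rule with premise set $\Phi$ and conclusion sets $\Psi_1,\ldots,\Psi_n$ ($n\ge1$), and for every finite $X\subseteq\mathsf{LF}\cup\mathsf{Id}$, the set $X\cup\Phi$ is $\mathsf{SCI}$-satisfiable iff $X\cup\Phi\cup\Psi_i$ is $\mathsf{SCI}$-satisfiable for some $i\in\{1,\ldots,n\}$.
   Context: Logic SCI. Fix a countably infinite set $\mathsf{AF}$ of atomic formulas. The set $\mathsf{FOR}$ of SCI-formulas is given by $\varphi ::= p \mid \neg\varphi \mid \varphi\to\varphi \mid \varphi\equiv\varphi$ with $p\in\mathsf{AF}$. An SCI-model is a structure $\mathcal{M}=\langle U,D,\tilde\neg,\tilde\to,\tilde\equiv\rangle$ where $U\neq\emptyset$, $D\subseteq U$, $\tilde\neg:U\to U$, $\tilde\to,\tilde\equiv:U\times U\to U$, such that for all $a,b\in U$: $\tilde\neg a\in D$ iff $a\notin D$; $a\tilde\to b\in D$ iff $a\notin D$ or $b\in D$; $a\tilde\equiv b\in D$ iff $a=b$. A valuation in $\mathcal{M}$ is a map $V:\mathsf{FOR}\to U$ with $V(\neg\varphi)=\tilde\neg V(\varphi)$, $V(\varphi\to\psi)=V(\varphi)\tilde\to V(\psi)$, $V(\varphi\equiv\psi)=V(\varphi)\tilde\equiv V(\psi)$. Labels: $\mathsf{L}^+,\mathsf{L}^-$ are disjoint countably infinite sets, $\mathsf{L}=\mathsf{L}^+\cup\mathsf{L}^-$; a label written $w^+$ lies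 in $\mathsf{L}^+$, $w^-$ in $\mathsf{L}^-$, an unsuperscripted label is arbitrary. $\mathsf{LF}$ is the set of labelled formulas $w:\varphi$; $\mathsf{Id}$ is the set of all expressions $w=v$ and $w\neq v$ with $w,v\in\mathsf{L}$. For finite $A\subseteq\mathsf{LF}$, $B\subseteq\mathsf{Id}$, $A\cup B$ is satisfied in an SCI-model $\mathcal{M}$ by a valuation $V$ and $f:\mathsf{L}\to U$ iff (1) $V(\varphi)=f(w)$ for all $w:\varphi\in A$; (2) $f(w)\in D$ iff $w\in\mathsf{L}^+$, for all labels $w$ occurring in $A\cup B$; (3) $f(w)=f(v)$ for all $w=v\in B$; (4) $f(w)\neq f(v)$ for all $w\neq v\in B$. $A\cup B$ is SCI-satisfiable if such $\mathcal{M},V,f$ exist. Rules (premises / alternative conclusion sets separated by $\mid$). Decomposition rules, in which the labels occurring in the conclusions are fresh, i.e. do not occur in $X\cup\Phi$: $(\neg^+)$ $w^+:\neg\varphi$ / $v^-:\varphi$; $(\neg^-)$ $w^-:\neg\varphi$ / $v^+:\varphi$; $(\to^+)$ $w^+:\varphi\to\psi$ / $\{v^-:\varphi,u^-:\psi\}\mid\{v^-:\varphi,u^+:\psi\}\mid\{v^+:\varphi,u^+:\psi\}$; $(\to^-)$ $w^-:\varphi\to\psi$ / $\{v^+:\varphi,u^-:\psi\}$; $(\equiv^+)$ $w^+:\varphi\equiv\psi$ / $\{v^+:\varphi,u^+:\psi,v^+=u^+\}\mid\{v^-:\varphi,u^-:\psi,v^-=u^-\}$; $(\equiv^-)$ $w^-:\varphi\equiv\psi$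 / $\{v^+:\varphi,u^+:\psi,v^+\neq u^+\}\mid\{v^+:\varphi,u^-:\psi\}\mid\{v^-:\varphi,u^+:\psi\}\mid\{v^-:\varphi,u^-:\psi,v^-\neq u^-\}$. Equality rules, where $\varphi\approx\psi$ abbreviates the three premises $w:\varphi$, $v:\psi$, $w=v$ for some labels $w,v$: $(\equiv^\neg)$ $\varphi\approx\psi$, $u:\neg\varphi$, $y:\neg\psi$ / $u=y$; $(\equiv^\to)$ $\varphi\approx\psi$, $\chi\approx\theta$, $x:\varphi\to\chi$, $z:\psi\to\theta$ / $x=z$; $(\equiv^\equiv)$ $\varphi\approx\psi$, $\chi\approx\theta$, $x:\varphi\equiv\chi$, $z:\psi\equiv\theta$ / $x=z$; $(\mathsf F)$ $w:\varphi$, $v:\varphi$ / $w=v$; $(\mathsf{sym})$ $w=v$ / $v=w$; $(\mathsf{tran})$ $w=v$, $v=u$ / $w=u$. -}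

module Defs where

open import Data.Nat using (ℕ)
open import Data.Bool using (Bool; true; false)
open import Data.Product using (Σ; _×_; _,_)
open import Data.Sum using (_⊎_)
open import Data.List using (List; []; _∷_; _++_; concatMap)
open import Data.List.Relation.Unary.All using (All)
open import Data.List.Membership.Propositional using (_∈_; _∉_)
open import Relation.Binary.PropositionalEquality using (_≡_; _≢_)
open import Relation.Nullary using (¬_)
open import Function.Bundles using (_⇔_)

data For : Set where
  atom : ℕ → For
  fneg : For → For
  fimp : For → For → For
  feqv : For → For → For

-- Labels: L⁺ = {pos} × ℕ, L⁻ = {neg} × ℕ (disjoint, countably infinite)

data Sign : Set where
  pos neg : Sign

Label : Set
Label = Sign × ℕ

data Expr : Set where
  lab : Label → For → Expr
  eq  : Label → Label → Expr
  neq : Label → Label → Expr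

labelsOf : Expr → List Label
labelsOf (lab w _) = w ∷ []
labelsOf (eq w v)  = w ∷ v ∷ []
labelsOf (neq w v) = w ∷ v ∷ []

Labels : List Expr → List Label
Labels = concatMap labelsOf

Fresh : Label → List Expr → Set
Fresh w Xs = w ∉ Labels Xs

-- SCI-models (D ⊆ U given by its characteristic function)

record Model : Set₁ where
  field
    U    : Set
    elem : U                       -- U ≠ ∅
    D    : U → Bool
    ¬̃    : U → U
    _→̃_  : U → U → U
    _≡̃_  : U → U → U
    ¬̃-D  : ∀ a → (D (¬̃ a) ≡ true) ⇔ (¬ (D a ≡ true))
    →̃-D  : ∀ a b → (D (a →̃ b) ≡ true) ⇔ ((¬ (D a ≡ true)) ⊎ (D b ≡ true))
    ≡̃-D  : ∀ a b → (D (a ≡̃ b) ≡ true) ⇔ (a ≡ b)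

record Valuation (M : Model) : Set where
  open Model M
  field
    V     : For → U
    V-neg : ∀ φ → V (fneg φ) ≡ ¬̃ (V φ)
    V-imp : ∀ φ ψ → V (fimp φ ψ) ≡ (V φ →̃ V ψ)
    V-eqv : ∀ φ ψ → V (feqv φ ψ) ≡ (V φ ≡̃ V ψ)

module _ (M : Model) (Val : Valuation M) (f : Label → Model.U M) where
  open Model M
  open Valuation Val

  SatExpr : Expr → Set
  SatExpr (lab w φ) = V φ ≡ f w
  SatExpr (eq w v)  = f w ≡ f v
  SatExpr (neq w v) = f w ≢ f v

  SignOf : Label → Sign
  SignOf (s , _) = s

  SatisfiedBy : List Expr → Set
  SatisfiedBy Xs =
    All SatExpr Xs ×
    (∀ w → w ∈ Labels Xs → (D (f w) ≡ true) ⇔ (SignOf w ≡ pos))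

Satisfiable : List Expr → Set₁
Satisfiable Xs =
  Σ Model λ M → Σ (Valuation M) λ Val → Σ (Label → Model.U M) λ f →
    SatisfiedBy M Val f Xs

-- Rule X Φ Ψs : Φ is the premise set, Ψs the list of alternative
-- conclusion sets.  Each conclusion set may choose its own fresh labels.

+_ -_ : ℕ → Label
+ n = pos , n
- n = neg , n

data Rule (X : List Expr) : List Expr → List (List Expr) → Set where
  ¬⁺ : ∀ {w} v φ → Fresh (- v) (X ++ lab (+ w) (fneg φ) ∷ []) →
       Rule X (lab (+ w) (fneg φ) ∷ []) ((lab (- v) φ ∷ []) ∷ [])
  ¬⁻ : ∀ {w} v φ → Fresh (+ v) (X ++ lab (- w) (fneg φ) ∷ []) →
       Rule X (lab (- w) (fneg φ) ∷ []) ((lab (+ v) φ ∷ []) ∷ [])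
  →⁺ : ∀ {w} v₁ u₁ v₂ u₂ v₃ u₃ φ ψ →
       let Φ = lab (+ w) (fimp φ ψ) ∷ [] in
       Fresh (- v₁) (X ++ Φ) → Fresh (- u₁) (X ++ Φ) → v₁ ≢ u₁ →
       Fresh (- v₂) (X ++ Φ) → Fresh (+ u₂) (X ++ Φ) →
       Fresh (+ v₃) (X ++ Φ) → Fresh (+ u₃) (X ++ Φ) → v₃ ≢ u₃ →
       Rule X Φ ((lab (- v₁) φ ∷ lab (- u₁) ψ ∷ []) ∷
                 (lab (- v₂) φ ∷ lab (+ u₂) ψ ∷ []) ∷
                 (lab (+ v₃) φ ∷ lab (+ u₃) ψ ∷ []) ∷ [])
  →⁻ : ∀ {w} v u φ ψ →
       let Φ = lab (- w) (fimp φ ψ) ∷ [] in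
       Fresh (+ v) (X ++ Φ) → Fresh (- u) (X ++ Φ) →
       Rule X Φ ((lab (+ v) φ ∷ lab (- u) ψ ∷ []) ∷ [])
  ≡⁺ : ∀ {w} v₁ u₁ v₂ u₂ φ ψ →
       let Φ = lab (+ w) (feqv φ ψ) ∷ [] in
       Fresh (+ v₁) (X ++ Φ) → Fresh (+ u₁) (X ++ Φ) → v₁ ≢ u₁ →
       Fresh (- v₂) (X ++ Φ) → Fresh (- u₂) (X ++ Φ) → v₂ ≢ u₂ →
       Rule X Φ ((lab (+ v₁) φ ∷ lab (+ u₁) ψ ∷ eq (+ v₁) (+ u₁) ∷ []) ∷
                 (lab (- v₂) φ ∷ lab (- u₂) ψ ∷ eq (- v₂) (- u₂) ∷ []) ∷ [])
  ≡⁻ : ∀ {w} v₁ u₁ v₂ u₂ v₃ u₃ v₄ u₄ φ ψ →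
       let Φ = lab (- w) (feqv φ ψ) ∷ [] in
       Fresh (+ v₁) (X ++ Φ) → Fresh (+ u₁) (X ++ Φ) → v₁ ≢ u₁ →
       Fresh (+ v₂) (X ++ Φ) → Fresh (- u₂) (X ++ Φ) →
       Fresh (- v₃) (X ++ Φ) → Fresh (+ u₃) (X ++ Φ) →
       Fresh (- v₄) (X ++ Φ) → Fresh (- u₄) (X ++ Φ) → v₄ ≢ u₄ →
       Rule X Φ ((lab (+ v₁) φ ∷ lab (+ u₁) ψ ∷ neq (+ v₁) (+ u₁) ∷ []) ∷
                 (lab (+ v₂) φ ∷ lab (- u₂) ψ ∷ []) ∷
                 (lab (- v₃) φ ∷ lab (+ u₃) ψ ∷ []) ∷
                 (lab (- v₄) φ ∷ lab (- u₄) ψ ∷ neq (- v₄) (- u₄) ∷ []) ∷ [])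
  -- equality rules  (φ ≈ ψ  abbreviates  w : φ, v : ψ, w = v)
  ≡¬ : ∀ (w v u y : Label) φ ψ →
       Rule X (lab w φ ∷ lab v ψ ∷ eq w v ∷ lab u (fneg φ) ∷ lab y (fneg ψ) ∷ [])
              ((eq u y ∷ []) ∷ [])
  ≡→ : ∀ (w v w′ v′ x z : Label) φ ψ χ θ →
       Rule X (lab w φ ∷ lab v ψ ∷ eq w v ∷
               lab w′ χ ∷ lab v′ θ ∷ eq w′ v′ ∷
               lab x (fimp φ χ) ∷ lab z (fimp ψ θ) ∷ [])
              ((eq x z ∷ []) ∷ [])
  ≡≡ : ∀ (w v w′ v′ x z : Label) φ ψ χ θ →
       Rule X (lab w φ ∷ lab v ψ ∷ eq w v ∷
               lab w′ χ ∷ lab v′ θ ∷ eq w′ v′ ∷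
               lab x (feqv φ χ) ∷ lab z (feqv ψ θ) ∷ [])
              ((eq x z ∷ []) ∷ [])
  F    : ∀ (w v : Label) φ → Rule X (lab w φ ∷ lab v φ ∷ []) ((eq w v ∷ []) ∷ [])
  sym  : ∀ (w v : Label) → Rule X (eq w v ∷ []) ((eq v w ∷ []) ∷ [])
  tran : ∀ (w v u : Label) → Rule X (eq w v ∷ eq v u ∷ []) ((eq w u ∷ []) ∷ [])

{-# OPTIONS --safe #-}
-- Backwards, a model of X ∪ Φ ∪ Ψ is a model of X ∪ Φ. Forwards, for a decomposition rule the
-- truth conditions of the model determine which of φ, ψ are designated (and whether they are
-- equal); this singles out a conclusion set whose labels carry the matching signs, and
-- interpreting its fresh labels as V φ and V ψ satisfies it without disturbing X ∪ Φ. For an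
-- equality rule the conclusion already holds under the same assignment of labels, because V
-- commutes with the connectives: compounds of formulas with equal values have equal values.
module Submission where

open import Defs
open import Data.Bool using (true; _≟_)
open import Data.List using (List; []; _∷_; _++_)
open import Data.List.Properties using (++-assoc; concatMap-++)
open import Data.List.Membership.Propositional using (_∈_)
open import Data.List.Membership.Propositional.Properties using (∈-++⁺ˡ; ∈-++⁻; ∈-lookup)
open import Data.List.Relation.Binary.Subset.Propositional using (_⊆_)
open import Data.List.Relation.Binary.Subset.Propositional.Properties
  using (concatMap⁺; xs⊆xs++ys; xs⊆ys++xs) renaming (++⁺ʳ to ⊆-++⁺ʳ)
open import Data.List.Relation.Unary.All as All using (All; []; _∷_)
open import Data.List.Relation.Unary.All.Properties using (anti-mono) renaming (++⁺ to All-++⁺)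
open import Data.List.Relation.Unary.Any using (Any; here; there)
open import Data.Fin using (#_)
import Data.Nat as ℕ
open import Data.Product using (_×_; _,_; proj₁)
open import Data.Product.Properties using (≡-dec)
open import Data.Sum using (_⊎_; inj₁; inj₂)
open import Data.Unit using (⊤; tt)
open import Function.Base using (_∘_)
open import Function.Bundles using (_⇔_; mk⇔; Equivalence)
open import Relation.Binary.Definitions using (DecidableEquality)
open import Relation.Binary.PropositionalEquality
  using (_≡_; _≢_; refl; cong; cong₂; subst; trans) renaming (sym to ≡-sym)
open import Relation.Nullary using (¬_; Dec; yes; no; contradiction)
open import Relation.Nullary.Decidable using (decidable-stable)

open Equivalence using (to; from)

Labels-++ : ∀ Xs Ys → Labels (Xs ++ Ys) ≡ Labels Xs ++ Labels Ys
Labels-++ = concatMap-++ labelsOf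

Labels-⊆ : ∀ {Xs Ys} → Xs ⊆ Ys → Labels Xs ⊆ Labels Ys
Labels-⊆ = concatMap⁺ labelsOf

labelsOf-⊆ : ∀ {e Xs} → e ∈ Xs → labelsOf e ⊆ Labels Xs
labelsOf-⊆ {e} e∈ w∈ = Labels-⊆ {e ∷ []} (λ { (here refl) → e∈ }) (∈-++⁺ˡ w∈)

_≟ˢ_ : DecidableEquality Sign
pos ≟ˢ pos = yes refl
pos ≟ˢ neg = no λ ()
neg ≟ˢ pos = no λ ()
neg ≟ˢ neg = yes refl

_≟ˡ_ : DecidableEquality Label
_≟ˡ_ = ≡-dec _≟ˢ_ ℕ._≟_

module _ {A : Set} where

  _[_↦_] : (Label → A) → Label → A → Label → A
  (f [ a ↦ x ]) w with w ≟ˡ a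
  ... | yes _ = x
  ... | no  _ = f w

  update-≡ : ∀ (f : Label → A) a x → (f [ a ↦ x ]) a ≡ x
  update-≡ f a x with a ≟ˡ a
  ... | yes _   = refl
  ... | no  a≢a = contradiction refl a≢a

  update-≢ : ∀ (f : Label → A) {a w} x → w ≢ a → (f [ a ↦ x ]) w ≡ f w
  update-≢ f {a} {w} x w≢a with w ≟ˡ a
  ... | yes w≡a = contradiction w≡a w≢a
  ... | no  _   = refl

index-≢ : ∀ {s v u} → v ≢ u → _≢_ {A = Label} (s , v) (s , u)
index-≢ v≢u refl = v≢u refl

fresh-≢ : ∀ {a w} Xs → Fresh a Xs → w ∈ Labels Xs → w ≢ a
fresh-≢ Xs a∉ w∈ refl = a∉ w∈

-- How the two fresh labels of a decomposition conclusion set are related: not at all, by = or by ≠.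
data Link : Set where
  unlinked equal unequal : Link

linked : Link → Label → Label → List Expr
linked unlinked a b = []
linked equal    a b = eq a b ∷ []
linked unequal  a b = neq a b ∷ []

Linked : {A : Set} → Link → A → A → Set
Linked unlinked x y = ⊤
Linked equal    x y = x ≡ y
Linked unequal  x y = x ≢ y

linked-⊆ : ∀ l a b → Labels (linked l a b) ⊆ a ∷ b ∷ []
linked-⊆ unlinked a b ()
linked-⊆ equal    a b w∈ = w∈
linked-⊆ unequal  a b w∈ = w∈

module Semantics (M : Model) (Val : Valuation M) where
  open Model M
  open Valuation Val

  Designated : U → Set
  Designated x = D x ≡ true

  designated? : ∀ x → Dec (Designated x)
  designated? x = D x ≟ true

  designated-fneg : ∀ φ → Designated (V (fneg φ)) ⇔ (¬ Designated (V φ))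
  designated-fneg φ rewrite V-neg φ = ¬̃-D (V φ)

  designated-fimp : ∀ φ ψ →
    Designated (V (fimp φ ψ)) ⇔ (¬ Designated (V φ) ⊎ Designated (V ψ))
  designated-fimp φ ψ rewrite V-imp φ ψ = →̃-D (V φ) (V ψ)

  designated-feqv : ∀ φ ψ → Designated (V (feqv φ ψ)) ⇔ (V φ ≡ V ψ)
  designated-feqv φ ψ rewrite V-eqv φ ψ = ≡̃-D (V φ) (V ψ)

  modus-ponens : ∀ φ ψ → Designated (V (fimp φ ψ)) → Designated (V φ) → Designated (V ψ)
  modus-ponens φ ψ d dφ with to (designated-fimp φ ψ) d
  ... | inj₁ ¬dφ = contradiction dφ ¬dφ
  ... | inj₂ dψ  = dψ

  undesignated-fneg : ∀ φ → ¬ Designated (V (fneg φ)) → Designated (V φ)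
  undesignated-fneg φ ¬d = decidable-stable (designated? (V φ)) (¬d ∘ from (designated-fneg φ))

  undesignated-fimp : ∀ φ ψ → ¬ Designated (V (fimp φ ψ)) → Designated (V φ) × ¬ Designated (V ψ)
  undesignated-fimp φ ψ ¬d =
    decidable-stable (designated? (V φ)) (¬d ∘ from (designated-fimp φ ψ) ∘ inj₁) ,
    ¬d ∘ from (designated-fimp φ ψ) ∘ inj₂

  undesignated-feqv : ∀ φ ψ → ¬ Designated (V (feqv φ ψ)) → V φ ≢ V ψ
  undesignated-feqv φ ψ ¬d = ¬d ∘ from (designated-feqv φ ψ)

  V-fneg-cong : ∀ {φ ψ} → V φ ≡ V ψ → V (fneg φ) ≡ V (fneg ψ)
  V-fneg-cong {φ} {ψ} φ≡ψ = trans (V-neg φ) (trans (cong ¬̃ φ≡ψ) (≡-sym (V-neg ψ)))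

  V-fimp-cong : ∀ {φ ψ χ θ} → V φ ≡ V ψ → V χ ≡ V θ → V (fimp φ χ) ≡ V (fimp ψ θ)
  V-fimp-cong {φ} {ψ} {χ} {θ} φ≡ψ χ≡θ =
    trans (V-imp φ χ) (trans (cong₂ _→̃_ φ≡ψ χ≡θ) (≡-sym (V-imp ψ θ)))

  V-feqv-cong : ∀ {φ ψ χ θ} → V φ ≡ V ψ → V χ ≡ V θ → V (feqv φ χ) ≡ V (feqv ψ θ)
  V-feqv-cong {φ} {ψ} {χ} {θ} φ≡ψ χ≡θ =
    trans (V-eqv φ χ) (trans (cong₂ _≡̃_ φ≡ψ χ≡θ) (≡-sym (V-eqv ψ θ)))

  ≈-values : ∀ f {w v φ ψ} → SatExpr M Val f (lab w φ) → SatExpr M Val f (lab v ψ) →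
             SatExpr M Val f (eq w v) → V φ ≡ V ψ
  ≈-values _ Vφ≡fw Vψ≡fv fw≡fv = trans Vφ≡fw (trans fw≡fv (≡-sym Vψ≡fv))

  labelled-equal : ∀ f {x z χ θ} → V χ ≡ V θ →
                   SatExpr M Val f (lab x χ) → SatExpr M Val f (lab z θ) → f x ≡ f z
  labelled-equal _ χ≡θ χ:x θ:z = trans (≡-sym χ:x) (trans χ≡θ θ:z)

  SignFits : Sign → U → Set
  SignFits s x = Designated x ⇔ (s ≡ pos)

  Fits : Label → U → Set
  Fits w = SignFits (proj₁ w)

  fits⁺ : ∀ {x} → Designated x → SignFits pos x
  fits⁺ d = mk⇔ (λ _ → refl) (λ _ → d)

  fits⁻ : ∀ {x} → ¬ Designated x → SignFits neg x
  fits⁻ ¬d = mk⇔ (λ d → contradiction d ¬d) (λ ())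

  fits⁺⁻¹ : ∀ {x} → SignFits pos x → Designated x
  fits⁺⁻¹ fits = from fits refl

  fits⁻⁻¹ : ∀ {x} → SignFits neg x → ¬ Designated x
  fits⁻⁻¹ fits d with to fits d
  ... | ()

  Sat : (Label → U) → List Expr → Set
  Sat = SatisfiedBy M Val

  Sat-anti-mono : ∀ {f Xs Ys} → Xs ⊆ Ys → Sat f Ys → Sat f Xs
  Sat-anti-mono Xs⊆Ys (exprs , signs) =
    anti-mono Xs⊆Ys exprs , λ w w∈ → signs w (Labels-⊆ Xs⊆Ys w∈)

  Sat-++⁺ : ∀ {f} Xs {Ys} → Sat f Xs → Sat f Ys → Sat f (Xs ++ Ys)
  Sat-++⁺ Xs {Ys} (exprsˣ , signsˣ) (exprsʸ , signsʸ) = All-++⁺ exprsˣ exprsʸ , signs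
    where
    signs : ∀ w → w ∈ Labels (Xs ++ Ys) → Fits w _
    signs w w∈ with ∈-++⁻ (Labels Xs) (subst (w ∈_) (Labels-++ Xs Ys) w∈)
    ... | inj₁ w∈ˣ = signsˣ w w∈ˣ
    ... | inj₂ w∈ʸ = signsʸ w w∈ʸ

  SatExpr-cong : ∀ {f g} e → (∀ {w} → w ∈ labelsOf e → f w ≡ g w) →
                 SatExpr M Val f e → SatExpr M Val g e
  SatExpr-cong (lab w φ) f≗g sat = trans sat (f≗g (here refl))
  SatExpr-cong (eq w v)  f≗g sat =
    trans (≡-sym (f≗g (here refl))) (trans sat (f≗g (there (here refl))))
  SatExpr-cong (neq w v) f≗g sat g≡ =
    sat (trans (f≗g (here refl)) (trans g≡ (≡-sym (f≗g (there (here refl))))))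

  Sat-cong : ∀ {f g} Xs → (∀ {w} → w ∈ Labels Xs → f w ≡ g w) → Sat f Xs → Sat g Xs
  Sat-cong Xs f≗g (exprs , signs) =
    All.tabulate (λ e∈ → SatExpr-cong _ (f≗g ∘ labelsOf-⊆ e∈) (All.lookup exprs e∈)) ,
    λ w w∈ → subst (Fits w) (f≗g w∈) (signs w w∈)

  Sat-fresh : ∀ {f a} Xs x → Fresh a Xs → Sat f Xs → Sat (f [ a ↦ x ]) Xs
  Sat-fresh {f} Xs x a∉ = Sat-cong Xs (λ w∈ → ≡-sym (update-≢ f x (fresh-≢ Xs a∉ w∈)))

  Sat-single : ∀ {f Xs a φ} → Fresh a Xs → Fits a (V φ) → Sat f Xs →
               Sat (f [ a ↦ V φ ]) (Xs ++ lab a φ ∷ [])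
  Sat-single {f} {Xs} {a} {φ} a∉ fits sat =
    Sat-++⁺ Xs (Sat-fresh Xs _ a∉ sat)
      (≡-sym fa ∷ [] , λ { _ (here refl) → subst (Fits a) (≡-sym fa) fits })
    where
    fa : (f [ a ↦ V φ ]) a ≡ V φ
    fa = update-≡ f a (V φ)

  Sat-pair : ∀ {f Xs a b φ ψ} l → Fresh a Xs → Fresh b Xs → a ≢ b →
             Fits a (V φ) → Fits b (V ψ) → Linked l (V φ) (V ψ) → Sat f Xs →
             Sat (f [ b ↦ V ψ ] [ a ↦ V φ ]) (Xs ++ lab a φ ∷ lab b ψ ∷ linked l a b)
  Sat-pair {f} {Xs} {a} {b} {φ} {ψ} l a∉ b∉ a≢b fitsᵃ fitsᵇ link sat =
    Sat-++⁺ Xs (Sat-fresh Xs _ a∉ (Sat-fresh Xs _ b∉ sat))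
      (≡-sym ga ∷ ≡-sym gb ∷ links l link , signs)
    where
    g : Label → U
    g = f [ b ↦ V ψ ] [ a ↦ V φ ]
    ga : g a ≡ V φ
    ga = update-≡ _ a (V φ)
    gb : g b ≡ V ψ
    gb = trans (update-≢ _ (V φ) (λ b≡a → a≢b (≡-sym b≡a))) (update-≡ f b (V ψ))
    links : ∀ l → Linked l (V φ) (V ψ) → All (SatExpr M Val g) (linked l a b)
    links unlinked _   = []
    links equal   φ≡ψ = trans ga (trans φ≡ψ (≡-sym gb)) ∷ []
    links unequal φ≢ψ = (λ ga≡gb → φ≢ψ (trans (≡-sym ga) (trans ga≡gb gb))) ∷ []
    new : ∀ {w} → w ∈ a ∷ b ∷ [] → Fits w (g w)
    new (here refl)         = subst (Fits a) (≡-sym ga) fitsᵃ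
    new (there (here refl)) = subst (Fits b) (≡-sym gb) fitsᵇ
    signs : ∀ w → w ∈ a ∷ b ∷ Labels (linked l a b) → Fits w (g w)
    signs w (here refl)         = new (here refl)
    signs w (there (here refl)) = new (there (here refl))
    signs w (there (there w∈))  = new (linked-⊆ l a b w∈)

  Sat-eq : ∀ {f Xs w v} → w ∈ Labels Xs → v ∈ Labels Xs → f w ≡ f v → Sat f Xs →
           Sat f (Xs ++ eq w v ∷ [])
  Sat-eq {Xs = Xs} w∈ v∈ fw≡fv sat@(_ , signs) =
    Sat-++⁺ Xs sat
      (fw≡fv ∷ [] , λ { _ (here refl) → signs _ w∈ ; _ (there (here refl)) → signs _ v∈ })

module Soundness (X : List Expr) (M : Model) (Val : Valuation M) where
  open Valuation Val
  open Semantics M Val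

  premises : ∀ {f} Φ → Sat f (X ++ Φ) → All (SatExpr M Val f) Φ
  premises Φ sat = anti-mono (xs⊆ys++xs Φ X) (proj₁ sat)

  premise-fits : ∀ {f w χ} → Sat f (X ++ lab w χ ∷ []) → Fits w (V χ)
  premise-fits {w = w} {χ} sat@(_ , signs) with premises (lab w χ ∷ []) sat
  ... | Vχ≡fw ∷ [] = subst (Fits w) (≡-sym Vχ≡fw) (signs w (Labels-⊆ (xs⊆ys++xs _ X) (here refl)))

  designated-premise : ∀ {f n χ} → Sat f (X ++ lab (+ n) χ ∷ []) → Designated (V χ)
  designated-premise sat = fits⁺⁻¹ (premise-fits sat)

  undesignated-premise : ∀ {f n χ} → Sat f (X ++ lab (- n) χ ∷ []) → ¬ Designated (V χ)
  undesignated-premise sat = fits⁻⁻¹ (premise-fits sat)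

  satisfiable-branch : ∀ {Φ} Ψ {g} → Sat g ((X ++ Φ) ++ Ψ) → Satisfiable (X ++ Φ ++ Ψ)
  satisfiable-branch {Φ} Ψ {g} sat = M , Val , g , subst (Sat g) (++-assoc X Φ Ψ) sat

  single-branch : ∀ {Φ f a φ} → Fresh a (X ++ Φ) → Fits a (V φ) → Sat f (X ++ Φ) →
                  Satisfiable (X ++ Φ ++ lab a φ ∷ [])
  single-branch a∉ fits sat = satisfiable-branch _ (Sat-single a∉ fits sat)

  pair-branch : ∀ {Φ f a b φ ψ} l → Fresh a (X ++ Φ) → Fresh b (X ++ Φ) → a ≢ b →
                Fits a (V φ) → Fits b (V ψ) → Linked l (V φ) (V ψ) → Sat f (X ++ Φ) →
                Satisfiable (X ++ Φ ++ lab a φ ∷ lab b ψ ∷ linked l a b)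
  pair-branch l a∉ b∉ a≢b fitsᵃ fitsᵇ link sat =
    satisfiable-branch _ (Sat-pair l a∉ b∉ a≢b fitsᵃ fitsᵇ link sat)

  eq-branch : ∀ {Φ f w v} → w ∈ Labels Φ → v ∈ Labels Φ → f w ≡ f v → Sat f (X ++ Φ) →
              Satisfiable (X ++ Φ ++ eq w v ∷ [])
  eq-branch {Φ} w∈ v∈ fw≡fv sat =
    satisfiable-branch _ (Sat-eq (in-context w∈) (in-context v∈) fw≡fv sat)
    where
    in-context : Labels Φ ⊆ Labels (X ++ Φ)
    in-context = Labels-⊆ (xs⊆ys++xs Φ X)

  -- In the equality rules the labels of the conclusion are located by their position in Labels Φ.
  some-branch : ∀ {Φ Ψs f} → Rule X Φ Ψs → Sat f (X ++ Φ) →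
                Any (λ Ψ → Satisfiable (X ++ Φ ++ Ψ)) Ψs
  some-branch (¬⁺ _ φ v∉) sat =
    here (single-branch v∉ (fits⁻ (to (designated-fneg φ) (designated-premise sat))) sat)
  some-branch (¬⁻ _ φ v∉) sat =
    here (single-branch v∉ (fits⁺ (undesignated-fneg φ (undesignated-premise sat))) sat)
  some-branch (→⁺ _ _ _ _ _ _ φ ψ v₁∉ u₁∉ v₁≢u₁ v₂∉ u₂∉ v₃∉ u₃∉ v₃≢u₃) sat
    with designated? (V φ) | designated? (V ψ)
  ... | no ¬dφ | no ¬dψ =
    here (pair-branch unlinked v₁∉ u₁∉ (index-≢ v₁≢u₁) (fits⁻ ¬dφ) (fits⁻ ¬dψ) tt sat)
  ... | no ¬dφ | yes dψ =
    there (here (pair-branch unlinked v₂∉ u₂∉ (λ ()) (fits⁻ ¬dφ) (fits⁺ dψ) tt sat))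
  ... | yes dφ | yes dψ =
    there (there (here (pair-branch unlinked v₃∉ u₃∉ (index-≢ v₃≢u₃) (fits⁺ dφ) (fits⁺ dψ) tt sat)))
  ... | yes dφ | no ¬dψ = contradiction (modus-ponens φ ψ (designated-premise sat) dφ) ¬dψ
  some-branch (→⁻ _ _ φ ψ v∉ u∉) sat with undesignated-fimp φ ψ (undesignated-premise sat)
  ... | dφ , ¬dψ = here (pair-branch unlinked v∉ u∉ (λ ()) (fits⁺ dφ) (fits⁻ ¬dψ) tt sat)
  some-branch (≡⁺ _ _ _ _ φ ψ v₁∉ u₁∉ v₁≢u₁ v₂∉ u₂∉ v₂≢u₂) sat
    with designated? (V φ) | to (designated-feqv φ ψ) (designated-premise sat)
  ... | yes dφ | φ≡ψ =
    here (pair-branch equal v₁∉ u₁∉ (index-≢ v₁≢u₁)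
      (fits⁺ dφ) (fits⁺ (subst Designated φ≡ψ dφ)) φ≡ψ sat)
  ... | no ¬dφ | φ≡ψ =
    there (here (pair-branch equal v₂∉ u₂∉ (index-≢ v₂≢u₂)
      (fits⁻ ¬dφ) (fits⁻ (¬dφ ∘ subst Designated (≡-sym φ≡ψ))) φ≡ψ sat))
  some-branch (≡⁻ _ _ _ _ _ _ _ _ φ ψ v₁∉ u₁∉ v₁≢u₁ v₂∉ u₂∉ v₃∉ u₃∉ v₄∉ u₄∉ v₄≢u₄) sat
    with designated? (V φ) | designated? (V ψ) | undesignated-feqv φ ψ (undesignated-premise sat)
  ... | yes dφ | yes dψ | φ≢ψ =
    here (pair-branch unequal v₁∉ u₁∉ (index-≢ v₁≢u₁) (fits⁺ dφ) (fits⁺ dψ) φ≢ψ sat)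
  ... | yes dφ | no ¬dψ | _ =
    there (here (pair-branch unlinked v₂∉ u₂∉ (λ ()) (fits⁺ dφ) (fits⁻ ¬dψ) tt sat))
  ... | no ¬dφ | yes dψ | _ =
    there (there (here (pair-branch unlinked v₃∉ u₃∉ (λ ()) (fits⁻ ¬dφ) (fits⁺ dψ) tt sat)))
  ... | no ¬dφ | no ¬dψ | φ≢ψ =
    there (there (there (here
      (pair-branch unequal v₄∉ u₄∉ (index-≢ v₄≢u₄) (fits⁻ ¬dφ) (fits⁻ ¬dψ) φ≢ψ sat))))
  some-branch {Φ} {f = f} (≡¬ _ _ _ _ _ _) sat with premises Φ sat
  ... | φ:w ∷ ψ:v ∷ w=v ∷ ¬φ:u ∷ ¬ψ:y ∷ [] =
    here (eq-branch (∈-lookup (# 4)) (∈-lookup (# 5))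
      (labelled-equal f (V-fneg-cong (≈-values f φ:w ψ:v w=v)) ¬φ:u ¬ψ:y) sat)
  some-branch {Φ} {f = f} (≡→ _ _ _ _ _ _ _ _ _ _) sat with premises Φ sat
  ... | φ:w ∷ ψ:v ∷ w=v ∷ χ:w′ ∷ θ:v′ ∷ w′=v′ ∷ φ→χ:x ∷ ψ→θ:z ∷ [] =
    here (eq-branch (∈-lookup (# 8)) (∈-lookup (# 9))
      (labelled-equal f (V-fimp-cong (≈-values f φ:w ψ:v w=v) (≈-values f χ:w′ θ:v′ w′=v′))
        φ→χ:x ψ→θ:z) sat)
  some-branch {Φ} {f = f} (≡≡ _ _ _ _ _ _ _ _ _ _) sat with premises Φ sat
  ... | φ:w ∷ ψ:v ∷ w=v ∷ χ:w′ ∷ θ:v′ ∷ w′=v′ ∷ φ≡χ:x ∷ ψ≡θ:z ∷ [] =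
    here (eq-branch (∈-lookup (# 8)) (∈-lookup (# 9))
      (labelled-equal f (V-feqv-cong (≈-values f φ:w ψ:v w=v) (≈-values f χ:w′ θ:v′ w′=v′))
        φ≡χ:x ψ≡θ:z) sat)
  some-branch {Φ} {f = f} (F _ _ _) sat with premises Φ sat
  ... | φ:w ∷ φ:v ∷ [] =
    here (eq-branch (∈-lookup (# 0)) (∈-lookup (# 1)) (labelled-equal f refl φ:w φ:v) sat)
  some-branch {Φ} (sym _ _) sat with premises Φ sat
  ... | w=v ∷ [] = here (eq-branch (∈-lookup (# 1)) (∈-lookup (# 0)) (≡-sym w=v) sat)
  some-branch {Φ} (tran _ _ _) sat with premises Φ sat
  ... | w=v ∷ v=u ∷ [] = here (eq-branch (∈-lookup (# 0)) (∈-lookup (# 3)) (trans w=v v=u) sat)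

satisfiable-premises : ∀ X Φ Ψs → Any (λ Ψ → Satisfiable (X ++ Φ ++ Ψ)) Ψs → Satisfiable (X ++ Φ)
satisfiable-premises X Φ (Ψ ∷ _) (here (M , Val , f , sat)) =
  M , Val , f , Semantics.Sat-anti-mono M Val (⊆-++⁺ʳ X (xs⊆xs++ys Φ Ψ)) sat
satisfiable-premises X Φ (_ ∷ Ψs) (there branch) = satisfiable-premises X Φ Ψs branch

proposition3 : (X Φ : List Expr) (Ψs : List (List Expr)) → Rule X Φ Ψs →
    Satisfiable (X ++ Φ) ⇔ Any (λ Ψ → Satisfiable (X ++ Φ ++ Ψ)) Ψs
proposition3 X Φ Ψs rule =
  mk⇔ (λ (M , Val , f , sat) → Soundness.some-branch X M Val rule sat) (satisfiable-premises X Φ Ψs)
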